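{- Let $A$ be an ordered graph and let $G\in\Gamma_3\,\mathbb{y}\,A\,\mathbb{x}\,\Gamma_3$, where $\Gamma_3$ is the ordered matching on $[6]$ with edges $\{1,3\},\{2,5\},\{4,6\}$. If $G$ is not separable and has no vertex of degree zero and no vertex of degree two, then $\mathcal{X}(G)$ avoids $G$.
   Context: An ordered graph is a finite simple graph whose vertex set is linearly ordered (identified with $[m]$ with the natural order). $H$ contains $G$ if there is an injective order-preserving map $\varphi:V(G)\to V(H)$ with $\varphi(u)\varphi(v)\in E(H)$ for all $uv\in E(G)$; otherwise $H$ avoids $G$. Edges are written $uv$ with $u<v$. $G$ is separable if its edge set can be partitioned into two non-empty parts $E_1,E_2$ with $u_1<v_1<u_2<v_2$ for all $u_1v_1\in E_1,u_2v_2\in E_2$. For ordered graphs $A,G_1,G_2$ on $n_0,n_1,n_2$ vertices, $G_1\,\mathbb{y}\,A\,\mathbb{x}\,G_2$ is the family of ordered graphs on $[n_1+n_0+n_2-2]$ obtained by choosing $i,j$ with $n_1\le i,j\le n_1+n_0-1$ and taking the union of a copy of $G_1$ placed on $\{1,\dots,n_1-1\}\cup\{i\}$, a copy of $A$ on $\{n_1,\dots,n_1+n_0-1\}$ and a copy of $G_2$ on $\{j\}\cup\{n_1+n_0,\dots,n_1+n_0+n_2-2\}$. An isolated edge is an edge whose both endpoints have degree one. For an ordered graph $G$ on $n$ vertices whose first and last vertices are each incident to an isolated edge, let $G'$ (resp. $G''$) be the ordered graph on $n-2$ vertices obtained from $G$ by deleting both endvertices of the edge incident to the first (resp. last) vertex;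 $\mathcal{X}(G)$ is the ordered graph on $[2n-6]$ obtained as the union of a copy of $G'$ placed on the first $n-2$ vertices and a copy of $G''$ placed on the last $n-2$ vertices (these overlap in two vertices). (Every $G\in\Gamma_3\,\mathbb{y}\,A\,\mathbb{x}\,\Gamma_3$ satisfies the requirement for $\mathcal{X}(G)$ to be defined.) -}

module Defs where

open import Data.Nat using (ℕ; zero; suc; _+_; _*_; _∸_; _≤_; _<_; _<ᵇ_)
open import Data.Fin using (Fin; toℕ; fromℕ<)
open import Data.Bool using (Bool; true; false; if_then_else_)
open import Data.Product using (Σ; ∃; ∃-syntax; _×_; _,_)
open import Data.Sum using (_⊎_)
open import Data.Empty using (⊥)
open import Data.Unit using (⊤)
open import Relation.Nullary using (¬_)
open import Relation.Binary.PropositionalEquality using (_≡_; _≢_)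
open import Function.Bundles using (_⇔_)

-- An ordered graph on [n] (vertices 0,…,n-1 with their natural order).
-- E u v is meaningful only for u < v: the edge set is { uv | u < v , E u v }.
-- Values of E on pairs u ≥ v are ignored by every notion below, so this is
-- exactly a finite simple graph on a linearly ordered vertex set.
record OGraph : Set₁ where
  field
    n : ℕ
    E : Fin n → Fin n → Set
open OGraph public

EN : (G : OGraph) → ℕ → ℕ → Set
EN G x y = Σ (x < n G) λ p → Σ (y < n G) λ q → E G (fromℕ< p) (fromℕ< q)

AdjN : (G : OGraph) → ℕ → ℕ → Set
AdjN G x y = (x < y × EN G x y) ⊎ (y < x × EN G y x)

Contains : (H G : OGraph) → Set
Contains H G =
  Σ (Fin (n G) → Fin (n H)) λ φ →
    (∀ u v → toℕ u < toℕ v → toℕ (φ u) < toℕ (φ v)) ×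
    (∀ u v → toℕ u < toℕ v → E G u v → E H (φ u) (φ v))

Avoids : (H G : OGraph) → Set
Avoids H G = ¬ Contains H G

Separable : OGraph → Set
Separable G =
  Σ (Fin (n G) → Fin (n G) → Bool) λ P →
    (∃[ u ] ∃[ v ] (toℕ u < toℕ v × E G u v × P u v ≡ true)) ×
    (∃[ u ] ∃[ v ] (toℕ u < toℕ v × E G u v × P u v ≡ false)) ×
    (∀ u₁ v₁ u₂ v₂ → toℕ u₁ < toℕ v₁ → E G u₁ v₁ → P u₁ v₁ ≡ true →
                     toℕ u₂ < toℕ v₂ → E G u₂ v₂ → P u₂ v₂ ≡ false →
                     toℕ v₁ < toℕ u₂)

DegZero : OGraph → ℕ → Set
DegZero G x = ∀ y → ¬ AdjN G x y

DegOne : OGraph → ℕ → Set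
DegOne G x = ∃[ y ] (AdjN G x y × (∀ z → AdjN G x z → z ≡ y))

DegTwo : OGraph → ℕ → Set
DegTwo G x = ∃[ y ] ∃[ w ] (y ≢ w × AdjN G x y × AdjN G x w ×
                             (∀ z → AdjN G x z → z ≡ y ⊎ z ≡ w))

IsolatedEdge : OGraph → ℕ → ℕ → Set
IsolatedEdge G x y = x < y × EN G x y × DegOne G x × DegOne G y

-- Γ₃: the ordered matching on [6] with edges {1,3},{2,5},{4,6}
-- (0-indexed: {0,2},{1,4},{3,5}).
E3 : ℕ → ℕ → Set
E3 0 2 = ⊤
E3 1 4 = ⊤
E3 3 5 = ⊤
E3 _ _ = ⊥

Γ₃ : OGraph
Γ₃ = record { n = 6 ; E = λ u v → E3 (toℕ u) (toℕ v) }

Img : (ℕ → ℕ) → OGraph → ℕ → ℕ → Set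
Img f H x y = ∃[ a ] ∃[ b ] (a < b × EN H a b × f a ≡ x × f b ≡ y)

-- G ∈ G₁ ⋎ A ⋏ G₂  (0-indexed).  With n₁,n₀,n₂ the sizes, G lives on
-- n₁+n₀+n₂-2 vertices; i, j range over [n₁-1, n₁+n₀-2] (1-indexed [n₁, n₁+n₀-1]).
-- G₁ is placed on {0,…,n₁-2} ∪ {i}, A on {n₁-1,…,n₁+n₀-2},
-- G₂ on {j} ∪ {n₁+n₀-1,…,n₁+n₀+n₂-3}, and G is the union of the three copies.
InFamily : (G₁ A G₂ G : OGraph) → Set
InFamily G₁ A G₂ G =
  (n G ≡ n G₁ + n A + n G₂ ∸ 2) ×
  ∃[ i ] ∃[ j ]
    (n G₁ ∸ 1 ≤ i × i ≤ n G₁ + n A ∸ 2 ×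
     n G₁ ∸ 1 ≤ j × j ≤ n G₁ + n A ∸ 2 ×
     (∀ x y → x < y →
        EN G x y ⇔ (Img (f₁ i) G₁ x y ⊎ Img fA A x y ⊎ Img (f₂ j) G₂ x y)))
  where
    f₁ : ℕ → ℕ → ℕ
    f₁ i k = if k <ᵇ (n G₁ ∸ 1) then k else i
    fA : ℕ → ℕ
    fA k = (n G₁ ∸ 1) + k
    f₂ : ℕ → ℕ → ℕ
    f₂ j zero = j
    f₂ j (suc k) = (n G₁ + n A ∸ 2) + suc k

-- 𝒳(G), given the isolated edges {0,a} and {b,n-1} of G.
-- G' = G minus {0,a}, relabelled order-preservingly onto [n-2] (map r);
-- G'' = G minus {b,n-1}, relabelled onto [n-2] (map s);
-- 𝒳(G) on [2n-6]: G' on the first n-2 vertices, G'' on the last n-2.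
𝒳 : (G : OGraph) → ℕ → ℕ → OGraph
𝒳 G a b = record { n = 2 * n G ∸ 6 ; E = λ p q → XE (toℕ p) (toℕ q) }
  where
    N = n G
    r : ℕ → ℕ
    r x = if a <ᵇ x then x ∸ 2 else x ∸ 1
    s : ℕ → ℕ
    s x = if b <ᵇ x then x ∸ 1 else x
    XE : ℕ → ℕ → Set
    XE p q =
      (∃[ x ] ∃[ y ] (x < y × EN G x y × x ≢ 0 × x ≢ a × y ≢ 0 × y ≢ a ×
                      r x ≡ p × r y ≡ q)) ⊎
      (∃[ x ] ∃[ y ] (x < y × EN G x y × x ≢ b × x ≢ N ∸ 1 × y ≢ b × y ≢ N ∸ 1 ×
                      s x + (N ∸ 4) ≡ p × s y + (N ∸ 4) ≡ q))

-- Write |A| = k + 1 (labels 0-indexed).  Then G has vertices 0, …, 10 + k, its isolated end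
-- edges are {0, 2} and {8 + k, 10 + k}, and 𝒳(G) glues G′ and G″ along the two positions
-- 7 + k and 8 + k.  Near this overlap 𝒳(G) is rigid: its edges into 7 + k and 8 + k come
-- from 4 + k and 6 + k, its edges out of them go to 9 + k and 11 + k, and no edge ends at
-- 6 + k.  A copy ψ of G in 𝒳(G) has ψ 0 < 6 + k and ψ (10 + k) ≥ 10 + k by counting, so
-- splitting the edges of G according to whether ψ sends their right end below 9 + k, resp.
-- below 8 + k, separates G unless the vertex sent to 7 + k has a right, resp. a left,
-- neighbour.  It cannot have both, since a vertex sent into the overlap with neighbours on
-- both sides has degree two.

module Submission where

open import Defs
open import Data.Nat using (ℕ; zero; suc; _+_; _∸_; _≤_; _<_; _<ᵇ_; z≤n; s≤s; z<s; s<s; s≤s⁻¹)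
open import Data.Nat.Properties
open import Data.Fin using (Fin; toℕ; fromℕ<) renaming (zero to fzero)
open import Data.Fin.Properties using (toℕ-injective; toℕ<n; fromℕ<-toℕ; toℕ-fromℕ<)
open import Data.Bool using (Bool; true; false; T; if_then_else_)
open import Data.Bool.Properties using (T-≡)
open import Data.Product using (∃-syntax; _×_; _,_; proj₁; proj₂)
open import Data.Sum using (_⊎_; inj₁; inj₂)
open import Data.Empty using (⊥; ⊥-elim)
open import Relation.Nullary using (¬_)
open import Relation.Nullary.Decidable using (dec-true; dec-false)
open import Relation.Binary using (tri<; tri≈; tri>)
open import Relation.Binary.PropositionalEquality
open import Function.Bundles using (Equivalence)

≤-suc-cases : ∀ {c a} → c ≤ a → a ≤ suc c → a ≡ c ⊎ a ≡ suc c
≤-suc-cases c≤a a≤1+c with m≤n⇒m<n∨m≡n a≤1+c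
... | inj₁ a<1+c = inj₁ (≤-antisym (s≤s⁻¹ a<1+c) c≤a)
... | inj₂ a≡1+c = inj₂ a≡1+c

Arc : (G : OGraph) → Fin (n G) → Fin (n G) → Set
Arc G u v = toℕ u < toℕ v × E G u v

arc-of-EN : (G : OGraph) {x y : ℕ} → x < y → (e : EN G x y) →
            Arc G (fromℕ< (proj₁ e)) (fromℕ< (proj₁ (proj₂ e)))
arc-of-EN G x<y (p , q , e) = subst₂ _<_ (sym (toℕ-fromℕ< p)) (sym (toℕ-fromℕ< q)) x<y , e

EN-of-E : (G : OGraph) {u v : Fin (n G)} → E G u v → EN G (toℕ u) (toℕ v)
EN-of-E G {u} {v} e =
  toℕ<n u , toℕ<n v , subst₂ (E G) (sym (fromℕ<-toℕ u _)) (sym (fromℕ<-toℕ v _)) e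

degTwo-of-unique-neighbours : (G : OGraph) {u w v : Fin (n G)} → Arc G u w → Arc G w v →
  (∀ {u′} → Arc G u′ w → u′ ≡ u) → (∀ {v′} → Arc G w v′ → v′ ≡ v) → DegTwo G (toℕ w)
degTwo-of-unique-neighbours G {u} {w} {v} (u<w , euw) (w<v , ewv) left right =
  toℕ u , toℕ v , <⇒≢ (<-trans u<w w<v) ,
  inj₂ (u<w , EN-of-E G euw) , inj₁ (w<v , EN-of-E G ewv) , neighbour
  where
    label : ∀ {z} (p : z < n G) {a} → fromℕ< p ≡ a → z ≡ toℕ a
    label p eq = trans (sym (toℕ-fromℕ< p)) (cong toℕ eq)
    neighbour : ∀ z → AdjN G (toℕ w) z → z ≡ toℕ u ⊎ z ≡ toℕ v
    neighbour z (inj₁ (w<z , pw , pz , e)) =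
      inj₂ (label pz (right (subst (toℕ w <_) (sym (toℕ-fromℕ< pz)) w<z ,
                             subst (λ a → E G a _) (fromℕ<-toℕ w pw) e)))
    neighbour z (inj₂ (z<w , pz , pw , e)) =
      inj₁ (label pz (left (subst (_< toℕ w) (sym (toℕ-fromℕ< pz)) z<w ,
                            subst (E G _) (fromℕ<-toℕ w pw) e)))

separable-by-threshold : (G : OGraph) (h : Fin (n G) → ℕ) (t : ℕ) →
  (∃[ u ] ∃[ v ] (Arc G u v × h v < t)) → (∃[ u ] ∃[ v ] (Arc G u v × t ≤ h v)) →
  (∀ {u₁ v₁ u₂ v₂} → Arc G u₁ v₁ → h v₁ < t → Arc G u₂ v₂ → t ≤ h v₂ → ¬ toℕ u₂ ≤ toℕ v₁) →
  Separable G
separable-by-threshold G h t (u , v , (u<v , e) , below) (u′ , v′ , (u′<v′ , e′) , above)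
                       disjoint =
  lower , (u , v , u<v , e , dec-true (h v <? t) below) ,
  (u′ , v′ , u′<v′ , e′ , dec-false (h v′ <? t) (≤⇒≯ above)) , separated
  where
    lower : Fin (n G) → Fin (n G) → Bool
    lower _ v = h v <ᵇ t
    separated : ∀ u₁ v₁ u₂ v₂ → toℕ u₁ < toℕ v₁ → E G u₁ v₁ → lower u₁ v₁ ≡ true →
                toℕ u₂ < toℕ v₂ → E G u₂ v₂ → lower u₂ v₂ ≡ false → toℕ v₁ < toℕ u₂
    separated _ _ _ _ l₁ e₁ s₁ l₂ e₂ s₂ =
      ≰⇒> (disjoint (l₁ , e₁) (is-lower s₁) (l₂ , e₂) (≮⇒≥ (not-lower s₂)))
      where
        is-lower : ∀ {v} → lower u v ≡ true → h v < t
        is-lower {v} s = <ᵇ⇒< (h v) t (Equivalence.from T-≡ s)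
        not-lower : ∀ {v} → lower u v ≡ false → ¬ h v < t
        not-lower s hv<t = subst T s (<⇒<ᵇ hv<t)

module Embedding {G H : OGraph} (φ : Fin (n G) → Fin (n H))
                 (φ-mono : ∀ u v → toℕ u < toℕ v → toℕ (φ u) < toℕ (φ v)) where

  ψ : Fin (n G) → ℕ
  ψ u = toℕ (φ u)

  ψ-injective : ∀ {u v} → ψ u ≡ ψ v → u ≡ v
  ψ-injective {u} {v} eq with <-cmp (toℕ u) (toℕ v)
  ... | tri< u<v _ _ = ⊥-elim (<⇒≢ (φ-mono u v u<v) eq)
  ... | tri≈ _ u≡v _ = toℕ-injective u≡v
  ... | tri> _ _ v<u = ⊥-elim (<⇒≢ (φ-mono v u v<u) (sym eq))

  ψ-mono-≤ : ∀ {u v} → toℕ u ≤ toℕ v → ψ u ≤ ψ v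
  ψ-mono-≤ {u} {v} u≤v with m≤n⇒m<n∨m≡n u≤v
  ... | inj₁ u<v = <⇒≤ (φ-mono u v u<v)
  ... | inj₂ u≡v = ≤-reflexive (cong ψ (toℕ-injective u≡v))

  ψ-spread : (first : 0 < n G) (u : Fin (n G)) → ψ (fromℕ< first) + toℕ u ≤ ψ u
  ψ-spread first u =
    subst (λ a → ψ (fromℕ< first) + toℕ u ≤ ψ a) (fromℕ<-toℕ u (toℕ<n u)) (spread (toℕ u) (toℕ<n u))
    where
      open ≤-Reasoning
      spread : ∀ x (p : x < n G) → ψ (fromℕ< first) + x ≤ ψ (fromℕ< p)
      spread zero p = ≤-reflexive (+-identityʳ _)
      spread (suc x) p = begin
        ψ (fromℕ< first) + suc x   ≡⟨ +-suc _ x ⟩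
        suc (ψ (fromℕ< first) + x) ≤⟨ s≤s (spread x x<n) ⟩
        suc (ψ (fromℕ< x<n))       ≤⟨ φ-mono _ _ x<1+x ⟩
        ψ (fromℕ< p)               ∎
        where
          x<n : x < n G
          x<n = <-trans (n<1+n x) p
          x<1+x : toℕ (fromℕ< x<n) < toℕ (fromℕ< p)
          x<1+x = subst₂ _<_ (sym (toℕ-fromℕ< x<n)) (sym (toℕ-fromℕ< p)) (n<1+n x)

E3-cases : ∀ {a b} → E3 a b → (a ≡ 0 × b ≡ 2) ⊎ (a ≡ 1 × b ≡ 4) ⊎ (a ≡ 3 × b ≡ 5)
E3-cases {0} {2} _ = inj₁ (refl , refl)
E3-cases {1} {4} _ = inj₂ (inj₁ (refl , refl))
E3-cases {3} {5} _ = inj₂ (inj₂ (refl , refl))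
E3-cases {2} {_} ()
E3-cases {suc (suc (suc (suc _)))} {_} ()
E3-cases {0} {0} ()
E3-cases {0} {1} ()
E3-cases {0} {suc (suc (suc _))} ()
E3-cases {1} {0} ()
E3-cases {1} {1} ()
E3-cases {1} {2} ()
E3-cases {1} {3} ()
E3-cases {1} {suc (suc (suc (suc (suc _))))} ()
E3-cases {3} {0} ()
E3-cases {3} {1} ()
E3-cases {3} {2} ()
E3-cases {3} {3} ()
E3-cases {3} {4} ()
E3-cases {3} {suc (suc (suc (suc (suc (suc _)))))} ()

Γ₃-image : ∀ (f : ℕ → ℕ) {x y} → Img f Γ₃ x y →
           (f 0 ≡ x × f 2 ≡ y) ⊎ (f 1 ≡ x × f 4 ≡ y) ⊎ (f 3 ≡ x × f 5 ≡ y)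
Γ₃-image f (a , b , _ , (p , q , e) , fa , fb)
  with E3-cases (subst₂ E3 (toℕ-fromℕ< p) (toℕ-fromℕ< q) e)
... | inj₁ (refl , refl)        = inj₁ (fa , fb)
... | inj₂ (inj₁ (refl , refl)) = inj₂ (inj₁ (fa , fb))
... | inj₂ (inj₂ (refl , refl)) = inj₂ (inj₂ (fa , fb))

-- In a member of Γ₃ ⋎ A ⋏ Γ₃ with |A| = k + 1 the first Γ₃ sits on 0, …, 4 and i, A on
-- 5, …, 5 + k, and the second Γ₃ on j and 6 + k, …, 10 + k.
data FamilyEdge (k i j : ℕ) : ℕ → ℕ → Set where
  first₀₂  : FamilyEdge k i j 0 2
  first₁₄  : FamilyEdge k i j 1 4
  first₃₅  : FamilyEdge k i j 3 i
  inA      : ∀ {x y} → 5 ≤ x → y ≤ 5 + k → FamilyEdge k i j x y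
  second₀₂ : FamilyEdge k i j j (7 + k)
  second₁₄ : FamilyEdge k i j (6 + k) (9 + k)
  second₃₅ : FamilyEdge k i j (8 + k) (10 + k)

family-size : ∀ {k EA} (G : OGraph) → InFamily Γ₃ (record { n = suc k ; E = EA }) Γ₃ G →
              n G ≡ 11 + k
family-size {k} G (size , _) = trans size (cong (5 +_) (+-comm k 6))

family-edge : ∀ {k EA} (G : OGraph) → InFamily Γ₃ (record { n = suc k ; E = EA }) Γ₃ G →
  ∃[ i ] ∃[ j ] (i ≤ 5 + k × 5 ≤ j × (∀ {x y} → x < y → EN G x y → FamilyEdge k i j x y))
family-edge {k} G (_ , i , j , _ , i≤5+k , 5≤j , _ , copies) = i , j , i≤5+k , 5≤j , classify
  where
    shifted : ∀ t {z} → (5 + k) + t ≡ z → t + (5 + k) ≡ z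
    shifted t = trans (+-comm t (5 + k))
    classify : ∀ {x y} → x < y → EN G x y → FamilyEdge k i j x y
    classify x<y e with Equivalence.to (copies _ _ x<y) e
    ... | inj₁ im with Γ₃-image _ im
    ...   | inj₁ (refl , refl)        = first₀₂
    ...   | inj₂ (inj₁ (refl , refl)) = first₁₄
    ...   | inj₂ (inj₂ (refl , refl)) = first₃₅
    classify x<y e | inj₂ (inj₁ (a , b , _ , (_ , b<1+k , _) , refl , refl)) =
      inA (m≤m+n 5 a) (+-monoʳ-≤ 5 (s≤s⁻¹ b<1+k))
    classify x<y e | inj₂ (inj₂ im) with Γ₃-image _ im
    ...   | inj₁ (refl , eq) = subst (FamilyEdge k i j j) (shifted 2 eq) second₀₂
    ...   | inj₂ (inj₁ (eq₁ , eq₂)) =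
      subst₂ (FamilyEdge k i j) (shifted 1 eq₁) (shifted 4 eq₂) second₁₄
    ...   | inj₂ (inj₂ (eq₁ , eq₂)) =
      subst₂ (FamilyEdge k i j) (shifted 3 eq₁) (shifted 5 eq₂) second₃₅

module FamilyNeighbourhoods {k i j : ℕ} (i≤5+k : i ≤ 5 + k) (5≤j : 5 ≤ j) {G : OGraph}
  (classify : ∀ {x y} → x < y → EN G x y → FamilyEdge k i j x y) where

  private
    beyond-A : ∀ c → ¬ suc c + (5 + k) ≤ 5 + k
    beyond-A c = <⇒≱ (m<n+m (5 + k) z<s)

  right-of-0 : ∀ {y} → 0 < y → EN G 0 y → y ≡ 2
  right-of-0 0<y e with classify 0<y e
  ... | first₀₂  = refl
  ... | second₀₂ = ⊥-elim (<⇒≱ z<s 5≤j)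

  right-of-1 : ∀ {y} → 1 < y → EN G 1 y → y ≡ 4
  right-of-1 1<y e with classify 1<y e
  ... | first₁₄  = refl
  ... | inA (s≤s ()) _
  ... | second₀₂ = ⊥-elim (<⇒≱ (s<s z<s) 5≤j)

  left-of-8+k : ∀ {x} → x < 8 + k → ¬ EN G x (8 + k)
  left-of-8+k x<8+k e with classify x<8+k e
  ... | first₃₅ = beyond-A 2 i≤5+k
  ... | inA _ 8+k≤5+k = beyond-A 2 8+k≤5+k

  left-of-9+k : ∀ {x} → x < 9 + k → EN G x (9 + k) → x ≡ 6 + k
  left-of-9+k x<9+k e with classify x<9+k e
  ... | first₃₅ = ⊥-elim (beyond-A 3 i≤5+k)
  ... | inA _ 9+k≤5+k = ⊥-elim (beyond-A 3 9+k≤5+k)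
  ... | second₁₄ = refl

  left-of-10+k : ∀ {x} → x < 10 + k → EN G x (10 + k) → x ≡ 8 + k
  left-of-10+k x<10+k e with classify x<10+k e
  ... | first₃₅ = ⊥-elim (beyond-A 4 i≤5+k)
  ... | inA _ 10+k≤5+k = ⊥-elim (beyond-A 4 10+k≤5+k)
  ... | second₃₅ = refl

module Overlap (k : ℕ) (Eg : Fin (11 + k) → Fin (11 + k) → Set) where

  G : OGraph
  G = record { n = 11 + k ; E = Eg }

  X : OGraph
  X = 𝒳 G 2 (8 + k)

  r s : ℕ → ℕ
  r x = if 2 <ᵇ x then x ∸ 2 else x ∸ 1
  s x = if (8 + k) <ᵇ x then x ∸ 1 else x

  r-bound : ∀ {y} → y < 11 + k → y ≢ 0 → y ≢ 2 → r y ≤ 8 + k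
  r-bound {0} _ y≢0 _ = ⊥-elim (y≢0 refl)
  r-bound {1} _ _ _ = z≤n
  r-bound {2} _ _ y≢2 = ⊥-elim (y≢2 refl)
  r-bound {suc (suc (suc _))} (s≤s (s≤s (s≤s bound))) _ _ = bound

  r-inverse : ∀ {y c} → y ≢ 0 → y ≢ 2 → r y ≡ suc c → y ≡ 3 + c
  r-inverse {0} y≢0 _ _ = ⊥-elim (y≢0 refl)
  r-inverse {2} _ y≢2 _ = ⊥-elim (y≢2 refl)
  r-inverse {suc (suc (suc _))} _ _ eq = cong (2 +_) eq

  s-inverse : ∀ {x c} → c < 8 + k → s x ≡ c → x ≡ c
  s-inverse {x} c<8+k eq with (8 + k) <ᵇ x in 8+k<ᵇx
  ... | false = eq
  ... | true  = ⊥-elim (<⇒≱ c<8+k (subst (8 + k ≤_) eq (∸-monoˡ-≤ 1 8+k<x)))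
    where
      8+k<x : 8 + k < x
      8+k<x = <ᵇ⇒< (8 + k) x (Equivalence.from T-≡ 8+k<ᵇx)

  module _ {i j : ℕ} (i≤5+k : i ≤ 5 + k) (5≤j : 5 ≤ j)
           (classify : ∀ {x y} → x < y → EN G x y → FamilyEdge k i j x y) where

    open FamilyNeighbourhoods i≤5+k 5≤j {G} classify

    X-sides : ∀ {p q} → Arc X p q → toℕ q ≤ 8 + k ⊎ 7 + k ≤ toℕ p
    X-sides (_ , inj₁ (_ , _ , _ , (_ , y<n , _) , _ , _ , y≢0 , y≢2 , _ , ry)) =
      inj₁ (subst (_≤ 8 + k) ry (r-bound y<n y≢0 y≢2))
    X-sides (_ , inj₂ (x , _ , _ , _ , _ , _ , _ , _ , sx , _)) =
      inj₂ (subst (7 + k ≤_) sx (m≤n+m (7 + k) (s x)))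

    X-into-8+k : ∀ {p q} → Arc X p q → toℕ q ≡ 8 + k → toℕ p ≡ 6 + k
    X-into-8+k (_ , inj₁ (x , y , x<y , e , _ , _ , y≢0 , y≢2 , rx , ry)) q≡8+k =
      trans (sym rx) (cong r (left-of-10+k (subst (x <_) y≡10+k x<y) (subst (EN G x) y≡10+k e)))
      where
        y≡10+k : y ≡ 10 + k
        y≡10+k = r-inverse y≢0 y≢2 (trans ry q≡8+k)
    X-into-8+k (p<q , inj₂ (x , y , _ , e , _ , _ , _ , _ , sx , sy)) q≡8+k =
      ⊥-elim (<⇒≢ (n<1+n 1) (right-of-0 z<s (subst₂ (EN G) x≡0 y≡1 e)))
      where
        y≡1 : y ≡ 1
        y≡1 = s-inverse (s<s z<s) (+-cancelʳ-≡ (7 + k) (s y) 1 (trans sy q≡8+k))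
        x≡0 : x ≡ 0
        x≡0 = s-inverse z<s
                (n<1⇒n≡0 (+-cancelʳ-< (7 + k) (s x) 1 (subst₂ _<_ (sym sx) q≡8+k p<q)))

    X-from-7+k : ∀ {p q} → Arc X p q → toℕ p ≡ 7 + k → toℕ q ≡ 9 + k
    X-from-7+k {q = q} a@(p<q , inj₁ (_ , y , _ , (_ , y<n , _) , _ , _ , y≢0 , y≢2 , _ , ry))
               p≡7+k =
      ⊥-elim (<⇒≢ (n<1+n (6 + k)) (trans (sym (X-into-8+k a q≡8+k)) p≡7+k))
      where
        q≡8+k : toℕ q ≡ 8 + k
        q≡8+k = ≤-antisym (subst (_≤ 8 + k) ry (r-bound y<n y≢0 y≢2)) (subst (_< _) p≡7+k p<q)
    X-from-7+k (_ , inj₂ (x , y , x<y , e , _ , _ , _ , _ , sx , sy)) p≡7+k =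
      trans (sym sy) (cong (λ z → s z + (7 + k))
                           (right-of-0 (subst (_< y) x≡0 x<y) (subst₂ (EN G) x≡0 refl e)))
      where
        x≡0 : x ≡ 0
        x≡0 = s-inverse z<s (+-cancelʳ-≡ (7 + k) (s x) 0 (trans sx p≡7+k))

    X-into-7+k : ∀ {p q} → Arc X p q → toℕ q ≡ 7 + k → toℕ p ≡ 4 + k
    X-into-7+k (_ , inj₁ (x , y , x<y , e , _ , _ , y≢0 , y≢2 , rx , ry)) q≡7+k =
      trans (sym rx) (cong r (left-of-9+k (subst (x <_) y≡9+k x<y) (subst (EN G x) y≡9+k e)))
      where
        y≡9+k : y ≡ 9 + k
        y≡9+k = r-inverse y≢0 y≢2 (trans ry q≡7+k)
    X-into-7+k (p<q , inj₂ (x , _ , _ , _ , _ , _ , _ , _ , sx , _)) q≡7+k =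
      ⊥-elim (<⇒≱ (subst (_ <_) q≡7+k p<q) (subst (7 + k ≤_) sx (m≤n+m (7 + k) (s x))))

    X-from-8+k : ∀ {p q} → Arc X p q → toℕ p ≡ 8 + k → toℕ q ≡ 11 + k
    X-from-8+k (p<q , inj₁ (_ , y , _ , (_ , y<n , _) , _ , _ , y≢0 , y≢2 , _ , ry)) p≡8+k =
      ⊥-elim (<⇒≱ (subst (_< _) p≡8+k p<q) (subst (_≤ 8 + k) ry (r-bound y<n y≢0 y≢2)))
    X-from-8+k (_ , inj₂ (x , y , x<y , e , _ , _ , _ , _ , sx , sy)) p≡8+k =
      trans (sym sy) (cong (λ z → s z + (7 + k))
                           (right-of-1 (subst (_< y) x≡1 x<y) (subst₂ (EN G) x≡1 refl e)))
      where
        x≡1 : x ≡ 1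
        x≡1 = s-inverse (s<s z<s) (+-cancelʳ-≡ (7 + k) (s x) 1 (trans sx p≡8+k))

    X-not-into-6+k : ∀ {p q} → Arc X p q → toℕ q ≢ 6 + k
    X-not-into-6+k (_ , inj₁ (x , y , x<y , e , _ , _ , y≢0 , y≢2 , _ , ry)) q≡6+k =
      left-of-8+k (subst (x <_) y≡8+k x<y) (subst (EN G x) y≡8+k e)
      where
        y≡8+k : y ≡ 8 + k
        y≡8+k = r-inverse y≢0 y≢2 (trans ry q≡6+k)
    X-not-into-6+k (_ , inj₂ (_ , y , _ , _ , _ , _ , _ , _ , _ , sy)) q≡6+k =
      1+n≰n (subst (7 + k ≤_) (trans sy q≡6+k) (m≤n+m (7 + k) (s y)))

    module Embedded (no-deg-two : ∀ x → x < n G → ¬ DegTwo G x) (non-separable : ¬ Separable G)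
                    (first-edge : EN G 0 2) (last-edge : EN G (8 + k) (10 + k))
                    (φ : Fin (11 + k) → Fin (n X))
                    (φ-mono : ∀ u v → toℕ u < toℕ v → toℕ (φ u) < toℕ (φ v))
                    (φ-hom : ∀ u v → toℕ u < toℕ v → Eg u v → E X (φ u) (φ v)) where

      open Embedding {G} {X} φ φ-mono

      arc : ∀ {u v} → Arc G u v → Arc X (φ u) (φ v)
      arc (u<v , e) = φ-mono _ _ u<v , φ-hom _ _ u<v e

      v₂ : Fin (11 + k)
      v₂ = fromℕ< (proj₁ (proj₂ first-edge))

      first-arc : Arc G fzero v₂
      first-arc = arc-of-EN G z<s first-edge

      last : Fin (11 + k)
      last = fromℕ< (proj₁ (proj₂ last-edge))

      last-arc : Arc G (fromℕ< (proj₁ last-edge)) last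
      last-arc = arc-of-EN G (m<n+m (8 + k) {2} z<s) last-edge

      X-size : n X ≡ (6 + k) + (10 + k)
      X-size = cong (5 +_) (begin
        k + (11 + (k + 0)) ≡⟨ cong (λ m → k + (11 + m)) (+-identityʳ k) ⟩
        k + (11 + k)       ≡⟨ +-suc k (10 + k) ⟩
        suc (k + (10 + k)) ∎)
        where open ≡-Reasoning

      spread : ψ fzero + (10 + k) ≤ ψ last
      spread = subst (λ x → ψ fzero + x ≤ ψ last) (toℕ-fromℕ< (proj₁ (proj₂ last-edge)))
                     (ψ-spread z<s last)

      ψ-0<6+k : ψ fzero < 6 + k
      ψ-0<6+k = +-cancelʳ-< (10 + k) (ψ fzero) (6 + k)
                  (≤-<-trans spread (subst (ψ last <_) X-size (toℕ<n (φ last))))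

      ψ-last≥10+k : 10 + k ≤ ψ last
      ψ-last≥10+k = ≤-trans (m≤n+m (10 + k) (ψ fzero)) spread

      ψ-v₂<8+k : ψ v₂ < 8 + k
      ψ-v₂<8+k with X-sides (arc first-arc)
      ... | inj₁ ≤8+k = ≤∧≢⇒< ≤8+k (λ at8 → <-irrefl (X-into-8+k (arc first-arc) at8) ψ-0<6+k)
      ... | inj₂ 7+k≤ = ⊥-elim (<⇒≱ (<-trans ψ-0<6+k (n<1+n (6 + k))) 7+k≤)

      ψ-source≥7+k : ∀ {u v} → Arc G u v → 8 + k < ψ v → 7 + k ≤ ψ u
      ψ-source≥7+k a 8+k<ψv with X-sides (arc a)
      ... | inj₁ ψv≤8+k = ⊥-elim (<⇒≱ 8+k<ψv ψv≤8+k)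
      ... | inj₂ 7+k≤ψu = 7+k≤ψu

      Overlapping : Fin (11 + k) → Set
      Overlapping w = ψ w ≡ 7 + k ⊎ ψ w ≡ 8 + k

      left-unique : ∀ {u u′ w} → Overlapping w → Arc G u w → Arc G u′ w → u′ ≡ u
      left-unique (inj₁ at7) a a′ =
        ψ-injective (trans (X-into-7+k (arc a′) at7) (sym (X-into-7+k (arc a) at7)))
      left-unique (inj₂ at8) a a′ =
        ψ-injective (trans (X-into-8+k (arc a′) at8) (sym (X-into-8+k (arc a) at8)))

      right-unique : ∀ {w v v′} → Overlapping w → Arc G w v → Arc G w v′ → v′ ≡ v
      right-unique (inj₁ at7) b b′ =
        ψ-injective (trans (X-from-7+k (arc b′) at7) (sym (X-from-7+k (arc b) at7)))
      right-unique (inj₂ at8) b b′ =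
        ψ-injective (trans (X-from-8+k (arc b′) at8) (sym (X-from-8+k (arc b) at8)))

      no-path-through-overlap : ∀ {u w v} → Overlapping w → Arc G u w → Arc G w v → ⊥
      no-path-through-overlap {w = w} ov a b = no-deg-two (toℕ w) (toℕ<n w)
        (degTwo-of-unique-neighbours G a b (left-unique ov a) (right-unique ov b))

      separable-unless-7+k-has-right : (∀ {w v} → ψ w ≡ 7 + k → ¬ Arc G w v) → Separable G
      separable-unless-7+k-has-right no-right =
        separable-by-threshold G ψ (9 + k)
          (_ , _ , first-arc , <-trans ψ-v₂<8+k (n<1+n (8 + k)))
          (_ , _ , last-arc , ≤-trans (m≤n+m (9 + k) 1) ψ-last≥10+k)
          disjoint
        where
          disjoint : ∀ {u₁ v₁ u₂ v₂} → Arc G u₁ v₁ → ψ v₁ < 9 + k → Arc G u₂ v₂ → 9 + k ≤ ψ v₂ →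
                     ¬ toℕ u₂ ≤ toℕ v₁
          disjoint {v₁ = v₁} a₁ ψv₁<9+k a₂ 9+k≤ψv₂ u₂≤v₁
            with ≤-suc-cases (ψ-source≥7+k a₂ 9+k≤ψv₂) (≤-trans (ψ-mono-≤ u₂≤v₁) (s≤s⁻¹ ψv₁<9+k))
          ... | inj₁ at7 = no-right at7 a₂
          ... | inj₂ at8 = no-path-through-overlap (inj₂ v₁-at8) a₁
                             (subst (λ w → Arc G w _) (ψ-injective (trans at8 (sym v₁-at8))) a₂)
            where
              v₁-at8 : ψ v₁ ≡ 8 + k
              v₁-at8 = ≤-antisym (s≤s⁻¹ ψv₁<9+k) (subst (_≤ ψ v₁) at8 (ψ-mono-≤ u₂≤v₁))

      separable-unless-7+k-has-left : (∀ {u w} → ψ w ≡ 7 + k → ¬ Arc G u w) → Separable G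
      separable-unless-7+k-has-left no-left =
        separable-by-threshold G ψ (8 + k)
          (_ , _ , first-arc , ψ-v₂<8+k)
          (_ , _ , last-arc , ≤-trans (m≤n+m (8 + k) 2) ψ-last≥10+k)
          disjoint
        where
          disjoint : ∀ {u₁ v₁ u₂ v₂} → Arc G u₁ v₁ → ψ v₁ < 8 + k → Arc G u₂ v₂ → 8 + k ≤ ψ v₂ →
                     ¬ toℕ u₂ ≤ toℕ v₁
          disjoint a₁ ψv₁<8+k a₂ 8+k≤ψv₂ u₂≤v₁ with m≤n⇒m<n∨m≡n 8+k≤ψv₂
          ... | inj₁ 8+k<ψv₂ =
            no-left (≤-antisym (s≤s⁻¹ ψv₁<8+k) (≤-trans (ψ-source≥7+k a₂ 8+k<ψv₂) (ψ-mono-≤ u₂≤v₁)))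
                    a₁
          ... | inj₂ 8+k≡ψv₂
            with ≤-suc-cases (subst (_≤ _) (X-into-8+k (arc a₂) (sym 8+k≡ψv₂)) (ψ-mono-≤ u₂≤v₁))
                             (s≤s⁻¹ ψv₁<8+k)
          ...   | inj₁ at6 = X-not-into-6+k (arc a₁) at6
          ...   | inj₂ at7 = no-left at7 a₁

      impossible : ⊥
      impossible =
        non-separable (separable-unless-7+k-has-right λ at7 w-arc →
          non-separable (separable-unless-7+k-has-left λ at7′ arc-w′ →
            no-path-through-overlap (inj₁ at7)
              (subst (Arc G _) (ψ-injective (trans at7′ (sym at7))) arc-w′) w-arc))

    𝒳-avoids : (∀ x → x < n G → ¬ DegTwo G x) → ¬ Separable G →
               ∀ a b → IsolatedEdge G 0 a → IsolatedEdge G b (10 + k) → Avoids (𝒳 G a b) G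
    𝒳-avoids no-deg-two non-separable a b (0<a , first-edge , _) (b<10+k , last-edge , _)
      with right-of-0 0<a first-edge | left-of-10+k b<10+k last-edge
    ... | refl | refl = λ (φ , φ-mono , φ-hom) →
      Embedded.impossible no-deg-two non-separable first-edge last-edge φ φ-mono φ-hom

lemma3 : (A G : OGraph) → InFamily Γ₃ A Γ₃ G → ¬ Separable G →
    (∀ x → x < n G → ¬ DegZero G x) →
    (∀ x → x < n G → ¬ DegTwo G x) →
    (a b : ℕ) → IsolatedEdge G 0 a → IsolatedEdge G b (n G ∸ 1) →
    Avoids (𝒳 G a b) G
lemma3 record { n = zero } _ (_ , _ , _ , 5≤i , i≤4 , _) = ⊥-elim (1+n≰n (≤-trans 5≤i i≤4))
lemma3 record { n = suc k ; E = EA } G@record { n = N ; E = Eg } family non-separable _ no-deg-two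
  with family-size G family
... | refl with family-edge G family
...   | _ , _ , i≤5+k , 5≤j , classify =
  Overlap.𝒳-avoids k Eg i≤5+k 5≤j classify no-deg-two non-separable
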